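{- Let $n \ge 1$ and let $P$ be any predicate on KRK positions on the $n \times n$ board. Suppose that for every such position $p$: $P(\mathcal{R}_h(p)) \Rightarrow P(p)$, $P(\mathcal{R}_v(p)) \Rightarrow P(p)$, and $P(\mathcal{R}_d(p)) \Rightarrow P(p)$. Suppose moreover that $P(p)$ holds for every position $p$ in canonical form. Then $P(p)$ holds for every KRK position $p$ on the $n\times n$ board.
   Context: Squares of the $n\times n$ board are pairs $(x,y)$ of integers with $0\le x,y\le n-1$. A KRK position consists of the square $(wk_x,wk_y)$ of the white king, the square $(bk_x,bk_y)$ of the black king, either the square $(wr_x,wr_y)$ of the white rook or the information that the rook has been captured, and the side to move; all pieces present are on pairwise distinct squares of the board. The reflections of squares are $\mathcal{R}_h(x,y)=(n-1-x,\,y)$, $\mathcal{R}_v(x,y)=(x,\,n-1-y)$, $\mathcal{R}_d(x,y)=(y,x)$; the reflected image of a position is obtained by applying the reflection to the square of every piece present (the side to move and whether the rook is captured are unchanged). A position is in canonical form if (i) the triple $(2bk_x+1,\,2wk_x+1,\,2wr_x+1)$ is lexicographically less than or equal to $(n,n,n)$, (ii) the triple $(2bk_y+1,\,2wk_y+1,\,2wr_y+1)$ is lexicographically less than or equal to $(n,n,n)$, and (iii) the triple $(bk_x,wk_x,wr_x)$ is lexicographically less than or equal to $(bk_y,wk_y,wr_y)$; if the rook has been captured, the third components of all these triples are ignored. -}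

module Defs where

open import Data.Nat using (ℕ; zero; suc; _+_; _*_; _∸_; _≤_; _<_)
open import Data.Product using (_×_; _,_; proj₁; proj₂)
open import Data.Maybe using (Maybe; just; nothing)
open import Data.List using (List; []; _∷_)
open import Data.Empty using (⊥)
open import Data.Unit using (⊤)
open import Data.Sum using (_⊎_)
open import Relation.Binary.PropositionalEquality using (_≡_; _≢_)

Square : Set
Square = ℕ × ℕ

data Side : Set where
  white black : Side

-- A (raw) KRK position: white king, black king, rook square or `nothing`
-- if the rook has been captured, side to move.
record Position : Set where
  constructor pos
  field
    wk   : Square
    bk   : Square
    wr   : Maybe Square
    side : Side
open Position public

OnBoard : ℕ → Square → Set
OnBoard n (x , y) = x < n × y < n

RookOK : ℕ → Square → Square → Maybe Square → Set
RookOK n w b nothing  = ⊤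
RookOK n w b (just r) = OnBoard n r × r ≢ w × r ≢ b

Valid : ℕ → Position → Set
Valid n p = OnBoard n (wk p) × OnBoard n (bk p) × wk p ≢ bk p
          × RookOK n (wk p) (bk p) (wr p)

Rh Rv Rd : ℕ → Square → Square
Rh n (x , y) = (n ∸ 1 ∸ x , y)
Rv n (x , y) = (x , n ∸ 1 ∸ y)
Rd n (x , y) = (y , x)

mapMaybe : (Square → Square) → Maybe Square → Maybe Square
mapMaybe f nothing  = nothing
mapMaybe f (just s) = just (f s)

reflect : (Square → Square) → Position → Position
reflect f p = pos (f (wk p)) (f (bk p)) (mapMaybe f (wr p)) (side p)

reflH reflV reflD : ℕ → Position → Position
reflH n = reflect (Rh n)
reflV n = reflect (Rv n)
reflD n = reflect (Rd n)

data LexLeq : List ℕ → List ℕ → Set where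
  lex-nil : LexLeq [] []
  lex-lt  : ∀ {a b xs ys} → a < b → LexLeq (a ∷ xs) (b ∷ ys)
  lex-eq  : ∀ {a xs ys} → LexLeq xs ys → LexLeq (a ∷ xs) (a ∷ ys)

triple : (Square → ℕ) → Position → List ℕ
triple f p with wr p
... | nothing = f (bk p) ∷ f (wk p) ∷ []
... | just r  = f (bk p) ∷ f (wk p) ∷ f r ∷ []

consts : ℕ → Position → List ℕ
consts n p with wr p
... | nothing = n ∷ n ∷ []
... | just _  = n ∷ n ∷ n ∷ []

odd-x odd-y : Square → ℕ
odd-x (x , y) = 2 * x + 1
odd-y (x , y) = 2 * y + 1

Canonical : ℕ → Position → Set
Canonical n p = LexLeq (triple odd-x p) (consts n p)
              × LexLeq (triple odd-y p) (consts n p)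
              × LexLeq (triple proj₁ p) (triple proj₂ p)

module Submission where

-- The three conditions of canonicity
-- are achieved one after another:
--   (i)   x-condition, by possibly applying R_h;
--   (ii)  y-condition, by possibly applying R_v, which keeps (i);
--   (iii) diagonal condition, by possibly applying R_d, which swaps (i) and (ii).
-- Each stage is an instance of one general reduction principle
-- (reduce-along): if every valid position or its image under a
-- validity-preserving reflection satisfies a condition C, and the earlier
-- conditions are invariant under that reflection, C may be assumed.
-- The dichotomies come from two facts about lexicographic order:
-- (i) and (ii) from "of two pointwise complementary lists (a + b = 2c), one
-- is ≤ the constant list c" (the x ↦ n-1-x mirror satisfies
-- (2x+1) + (2(n-1-x)+1) = 2n), and (iii) from totality of the order.

open import Defs
open import Data.Nat using (ℕ; _≥_; _+_; _*_; _∸_; _<_; s≤s)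
open import Data.Nat.Properties
  using (<-cmp; +-cancelˡ-≡; +-cancelˡ-<; +-monoˡ-<; m∸n≤m; ∸-cancelˡ-≡; m+[n∸m]≡n; suc-injective)
open import Data.Nat.Tactic.RingSolver using (solve-∀)
open import Data.Product using (_×_; _,_; proj₁; proj₂)
open import Data.Maybe using (just; nothing)
open import Data.List using (List; []; _∷_; length; replicate)
open import Data.List.Relation.Binary.Pointwise using (Pointwise; []; _∷_)
open import Data.Sum using (_⊎_; inj₁; inj₂) renaming (map to ⊎-map)
open import Data.Unit using (⊤; tt)
open import Relation.Binary using (tri<; tri≈; tri>)
open import Relation.Binary.PropositionalEquality
  using (_≡_; _≢_; refl; sym; trans; cong; cong₂; subst)

lex-total : (xs ys : List ℕ) → length xs ≡ length ys → LexLeq xs ys ⊎ LexLeq ys xs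
lex-total []       []       _ = inj₁ lex-nil
lex-total (a ∷ xs) (b ∷ ys) eq with <-cmp a b
... | tri< a<b _ _ = inj₁ (lex-lt a<b)
... | tri≈ _ refl _ = ⊎-map lex-eq lex-eq (lex-total xs ys (suc-injective eq))
... | tri> _ _ b<a = inj₂ (lex-lt b<a)

complement-below : ∀ {a b c} → a + b ≡ c + c → c < a → b < c
complement-below {a} {b} {c} sum c<a =
  +-cancelˡ-< a b c (subst (_< a + c) (sym sum) (+-monoˡ-< c c<a))

-- Of two lists whose entries pairwise add up to 2c, one is lexicographically
-- below the constant list c: the first differing entry can only exceed c in
-- one of them.
lex-complement : ∀ {c xs ys} → Pointwise (λ a b → a + b ≡ c + c) xs ys
               → LexLeq xs (replicate (length xs) c) ⊎ LexLeq ys (replicate (length ys) c)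
lex-complement [] = inj₁ lex-nil
lex-complement {c} (_∷_ {a} {b} sum rest) with <-cmp a c
... | tri< a<c _ _ = inj₁ (lex-lt a<c)
... | tri> _ _ c<a = inj₂ (lex-lt (complement-below sum c<a))
... | tri≈ _ refl _ with +-cancelˡ-≡ a b a sum
...   | refl = ⊎-map lex-eq lex-eq (lex-complement rest)

mirror-bound : ∀ {n x} → x < n → n ∸ 1 ∸ x < n
mirror-bound {x = x} (s≤s {n = m} _) = s≤s (m∸n≤m m x)

mirror-injective : ∀ {n x y} → x < n → y < n → n ∸ 1 ∸ x ≡ n ∸ 1 ∸ y → x ≡ y
mirror-injective (s≤s x≤m) (s≤s y≤m) = ∸-cancelˡ-≡ x≤m y≤m

mirror-complement : ∀ {n x} → x < n → (2 * x + 1) + (2 * (n ∸ 1 ∸ x) + 1) ≡ n + n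
mirror-complement {x = x} (s≤s {n = m} x≤m) =
  trans (double-sum x (m ∸ x)) (cong (λ k → 1 + k + (1 + k)) (m+[n∸m]≡n x≤m))
  where
  double-sum : ∀ x k → (2 * x + 1) + (2 * k + 1) ≡ 1 + (x + k) + (1 + (x + k))
  double-sum = solve-∀

record BoardSymmetry (n : ℕ) (f : Square → Square) : Set where
  field
    on-board  : ∀ {s} → OnBoard n s → OnBoard n (f s)
    injective : ∀ {s t} → OnBoard n s → OnBoard n t → f s ≡ f t → s ≡ t

  distinct : ∀ {s t} → OnBoard n s → OnBoard n t → s ≢ t → f s ≢ f t
  distinct os ot s≢t fs≡ft = s≢t (injective os ot fs≡ft)

reflect-valid : ∀ {n f} → BoardSymmetry n f → ∀ p → Valid n p → Valid n (reflect f p)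
reflect-valid σ (pos w b nothing s) (ow , ob , w≢b , _) =
  on-board ow , on-board ob , distinct ow ob w≢b , tt
  where open BoardSymmetry σ
reflect-valid σ (pos w b (just r) s) (ow , ob , w≢b , or , r≢w , r≢b) =
  on-board ow , on-board ob , distinct ow ob w≢b ,
  on-board or , distinct or ow r≢w , distinct or ob r≢b
  where open BoardSymmetry σ

Rh-symmetry : ∀ n → BoardSymmetry n (Rh n)
Rh-symmetry n = record
  { on-board  = λ (x< , y<) → mirror-bound x< , y<
  ; injective = λ (x< , _) (x<′ , _) eq →
      cong₂ _,_ (mirror-injective x< x<′ (cong proj₁ eq)) (cong proj₂ eq)
  }

Rv-symmetry : ∀ n → BoardSymmetry n (Rv n)
Rv-symmetry n = record
  { on-board  = λ (x< , y<) → x< , mirror-bound y<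
  ; injective = λ (_ , y<) (_ , y<′) eq →
      cong₂ _,_ (cong proj₁ eq) (mirror-injective y< y<′ (cong proj₂ eq))
  }

Rd-symmetry : ∀ n → BoardSymmetry n (Rd n)
Rd-symmetry n = record
  { on-board  = λ (x< , y<) → y< , x<
  ; injective = λ _ _ eq → cong₂ _,_ (cong proj₂ eq) (cong proj₁ eq)
  }

XCondition YCondition : ℕ → Position → Set
XCondition n p = LexLeq (triple odd-x p) (consts n p)
YCondition n p = LexLeq (triple odd-y p) (consts n p)

DCondition : Position → Set
DCondition p = LexLeq (triple proj₁ p) (triple proj₂ p)

axis-dichotomy : ∀ {n} (c : Square → ℕ) (f : Square → Square)
  → (∀ {s} → OnBoard n s → c s + c (f s) ≡ n + n)
  → ∀ p → Valid n p
  → LexLeq (triple c p) (consts n p) ⊎ LexLeq (triple c (reflect f p)) (consts n (reflect f p))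
axis-dichotomy c f compl (pos w b nothing s) (ow , ob , _) =
  lex-complement (compl ob ∷ compl ow ∷ [])
axis-dichotomy c f compl (pos w b (just r) s) (ow , ob , _ , or , _) =
  lex-complement (compl ob ∷ compl ow ∷ compl or ∷ [])

x-dichotomy : ∀ n p → Valid n p → XCondition n p ⊎ XCondition n (reflH n p)
x-dichotomy n = axis-dichotomy odd-x (Rh n) (λ (x< , _) → mirror-complement x<)

y-dichotomy : ∀ n p → Valid n p → YCondition n p ⊎ YCondition n (reflV n p)
y-dichotomy n = axis-dichotomy odd-y (Rv n) (λ (_ , y<) → mirror-complement y<)

-- R_d exchanges the two sides of the diagonal condition, so by totality one
-- of p and R_d(p) satisfies it.
d-dichotomy : ∀ n p → DCondition p ⊎ DCondition (reflD n p)
d-dichotomy n (pos (wx , wy) (bx , by) nothing s) =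
  lex-total (bx ∷ wx ∷ []) (by ∷ wy ∷ []) refl
d-dichotomy n (pos (wx , wy) (bx , by) (just (rx , ry)) s) =
  lex-total (bx ∷ wx ∷ rx ∷ []) (by ∷ wy ∷ ry ∷ []) refl

-- R_v does not move x-coordinates.
reflV-keeps-x : ∀ n p → XCondition n p → XCondition n (reflV n p)
reflV-keeps-x n (pos w b nothing s) cx = cx
reflV-keeps-x n (pos w b (just r) s) cx = cx

reflD-swaps-xy : ∀ n p → XCondition n p × YCondition n p
               → XCondition n (reflD n p) × YCondition n (reflD n p)
reflD-swaps-xy n (pos w b nothing s) (cx , cy) = cy , cx
reflD-swaps-xy n (pos w b (just r) s) (cx , cy) = cy , cx

reduce-along : ∀ {n} (P : Position → Set) (r : Position → Position) (A C : Position → Set)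
  → (∀ p → Valid n p → Valid n (r p))
  → (∀ p → Valid n p → P (r p) → P p)
  → (∀ p → Valid n p → C p ⊎ C (r p))
  → (∀ p → A p → A (r p))
  → (∀ p → Valid n p → A p → C p → P p)
  → ∀ p → Valid n p → A p → P p
reduce-along P r A C r-valid pull-back split r-keeps-A prove p v a with split p v
... | inj₁ c = prove p v a c
... | inj₂ c = pull-back p v (prove (r p) (r-valid p v) (r-keeps-A p a) c)

mainTheorem2 : (n : ℕ) → n ≥ 1 → (P : Position → Set)
    → (∀ p → Valid n p → P (reflH n p) → P p)
    → (∀ p → Valid n p → P (reflV n p) → P p)
    → (∀ p → Valid n p → P (reflD n p) → P p)
    → (∀ p → Valid n p → Canonical n p → P p)
    → ∀ p → Valid n p → P p
mainTheorem2 n _ P fromH fromV fromD canonical p v = reduceX p v tt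
  where
  reduceD : ∀ p → Valid n p → XCondition n p × YCondition n p → P p
  reduceD = reduce-along P (reflD n) (λ p → XCondition n p × YCondition n p) DCondition
    (reflect-valid (Rd-symmetry n)) fromD (λ p _ → d-dichotomy n p) (reflD-swaps-xy n)
    (λ p v (cx , cy) cd → canonical p v (cx , cy , cd))

  reduceY : ∀ p → Valid n p → XCondition n p → P p
  reduceY = reduce-along P (reflV n) (XCondition n) (YCondition n)
    (reflect-valid (Rv-symmetry n)) fromV (y-dichotomy n) (reflV-keeps-x n)
    (λ p v cx cy → reduceD p v (cx , cy))

  reduceX : ∀ p → Valid n p → ⊤ → P p
  reduceX = reduce-along P (reflH n) (λ _ → ⊤) (XCondition n)
    (reflect-valid (Rh-symmetry n)) fromH (x-dichotomy n) (λ _ _ → tt)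
    (λ p v _ cx → reduceY p v cx)
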